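{- Let $H$ be a finite digraph possibly with loops, $D$ a finite $H$-colored digraph without loops and without isolated vertices, and $\xi=\{C_1,\dots,C_k\}$ ($k\ge2$) a partition of $V(H)$ such that for every $i$ the set $A_i=\{a\in A(D):c(a)\in C_i\}$ is nonempty and $G_i=D[A_i]$ is transitive by $H$-paths. Suppose that (1) for every cycle $\gamma$ in $D$ there exists $i\in\{1,\dots,k\}$ such that $\gamma$ is contained in $G_i$, and (2) for every $H$-walk $P$ in $D$ there exists $j\in\{1,\dots,k\}$ such that $P$ is contained in $G_j$. If $(u_0,u_1,\dots,u_{n-1})$ is a sequence of $n\ge2$ pairwise distinct vertices such that for every $i\in\{0,\dots,n-1\}$ there exists a $u_iu_{i+1}$-$H$-path $T_i$ in $D$ (indices modulo $n$), then there exists $j\in\{1,\dots,k\}$ such that $\bigcup_{i=0}^{n-1}T_i$ is contained in $G_j$.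
   Context: Paths, walks and cycles are directed; a path has pairwise distinct vertices. $D$ is $H$-colored if it has an arc coloring $c:A(D)\to V(H)$. A walk $(v_0,\dots,v_n)$ is an $H$-walk if $(c(v_0,v_1),\dots,c(v_{n-1},v_n))$ is a walk in $H$ (a single arc is an $H$-walk); an $H$-path is a path that is an $H$-walk. $D[A]$ for an arc set $A$ is the subdigraph with arc set $A$ and vertex set the ends of arcs in $A$. A subdigraph $G$ is transitive by $H$-paths if an $xy$-$H$-path contained in $G$ and a $yz$-$H$-path contained in $G$ imply an $xz$-$H$-path contained in $G$. -}

module Defs where

open import Data.Nat using (ℕ; suc; _≤_; NonZero)
open import Data.Nat.DivMod using (_mod_)
open import Data.Fin using (Fin; toℕ)
open import Data.Bool using (Bool; true; false)
open import Data.List using (List; []; _∷_; _++_)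
open import Data.List.Relation.Unary.All using (All)
open import Data.List.Relation.Unary.Unique.Propositional using (Unique)
open import Data.Product using (Σ; ∃; ∃-syntax; _×_; _,_)
open import Data.Sum using (_⊎_)
open import Relation.Binary.PropositionalEquality using (_≡_; _≢_)
open import Relation.Nullary using (¬_)

-- A finite digraph H (loops allowed) on vertex set Fin hV with arc relation HA,
-- and a finite digraph D on vertex set Fin dV with arc relation DA (no parallel arcs),
-- together with an H-coloring of the arcs of D.  The coloring c is given as a
-- total function on ordered pairs; only its values on arcs of D are ever used.
record HColoredDigraph : Set where
  field
    hV : ℕ
    HA : Fin hV → Fin hV → Bool
    dV : ℕ
    DA : Fin dV → Fin dV → Bool
    c  : Fin dV → Fin dV → Fin hV
open HColoredDigraph public

pairs : {A : Set} → List A → List (A × A)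
pairs []             = []
pairs (x ∷ [])       = []
pairs (x ∷ y ∷ xs)   = (x , y) ∷ pairs (y ∷ xs)

module _ (Δ : HColoredDigraph) where
  private
    V = Fin (dV Δ)

  -- the vertex sequence of a walk from x to y with interior vertex list ms
  -- (every walk considered has at least one arc)
  seq : V → List V → V → List V
  seq x ms y = x ∷ (ms ++ (y ∷ []))

  IsArc : V × V → Set
  IsArc (x , y) = DA Δ x y ≡ true

  HCompatible : (V × V) × (V × V) → Set
  HCompatible ((x , y) , (y' , z)) = HA Δ (c Δ x y) (c Δ y' z) ≡ true

  IsWalk : List V → Set
  IsWalk vs = All IsArc (pairs vs)

  IsHWalk : List V → Set
  IsHWalk vs = IsWalk vs × All HCompatible (pairs (pairs vs))

  IsHPath : List V → Set
  IsHPath vs = IsHWalk vs × Unique vs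

  IsCycle : V → V → List V → Set
  IsCycle v w ws = IsWalk (v ∷ w ∷ ws ++ (v ∷ [])) × Unique (v ∷ w ∷ ws)

  -- a walk (given by its vertex sequence) is contained in a subdigraph D[A]
  -- where A = {a ∈ A(D) : c(a) ∈ C_j}, C_j = {h : part h ≡ j}
  ContainedIn : {k : ℕ} → (Fin (hV Δ) → Fin k) → Fin k → List V → Set
  ContainedIn part j vs = All (λ { (x , y) → part (c Δ x y) ≡ j }) (pairs vs)

  HPathIn : {k : ℕ} → (Fin (hV Δ) → Fin k) → Fin k → V → List V → V → Set
  HPathIn part j x ms y = IsHPath (seq x ms y) × ContainedIn part j (seq x ms y)

  -- G_j is transitive by H-paths (x ≠ z required since a path has distinct vertices)
  TransitiveByHPaths : {k : ℕ} → (Fin (hV Δ) → Fin k) → Fin k → Set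
  TransitiveByHPaths part j =
    ∀ x y z ms₁ ms₂ → x ≢ z → HPathIn part j x ms₁ y → HPathIn part j y ms₂ z →
    ∃[ ms₃ ] HPathIn part j x ms₃ z

  Loopless : Set
  Loopless = ∀ v → DA Δ v v ≡ false

  NoIsolated : Set
  NoIsolated = ∀ v → ∃[ u ] (DA Δ v u ≡ true ⊎ DA Δ u v ≡ true)

  ArcClassNonempty : {k : ℕ} → (Fin (hV Δ) → Fin k) → Fin k → Set
  ArcClassNonempty part j = ∃[ x ] ∃[ y ] (DA Δ x y ≡ true × part (c Δ x y) ≡ j)

nextMod : {m : ℕ} → Fin (suc (suc m)) → Fin (suc (suc m))
nextMod {m} i = suc (toℕ i) mod suc (suc m)

-- The H-paths T_i are chained into a closed walk.  Each T_i lies in one class G_j, by (2).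
-- Concatenate T_0, T_1, … as long as the result stays a path; the closed walk must eventually
-- return to a vertex already visited, and the cycle closed at that moment passes through the
-- junction u_r of the last two paths, using the last arc of T_{r-1} and the first arc of T_r.
-- By (1) this cycle lies in one class, so T_{r-1} and T_r lie in the same G_j.  Since the u_i are
-- distinct, G_j being transitive by H-paths merges T_{r-1} and T_r into one u_{r-1}u_{r+1}-H-path
-- in G_j, and induction on the number of paths finishes the proof.
module Submission where

open import Defs
open import Data.Nat using (ℕ; zero; suc; _≤_; _<_; s≤s; s≤s⁻¹; z<s; s<s; _%_)
open import Data.Nat.Properties
  using (≤-refl; <-trans; ≤-reflexive; ≤-trans; n≤1+n; m≤n⇒m<n∨m≡n; <-irrefl; 1+n≢0; suc-injective)
open import Data.Nat.DivMod using (m<n⇒m%n≡m; n%n≡0)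
open import Data.Fin using (Fin; toℕ; zero)
open import Data.Fin.Properties using (_≟_; toℕ-fromℕ<; toℕ-injective; toℕ<n)
open import Data.List using (List; []; _∷_; _++_; map; length; applyUpTo)
open import Data.List.Properties using (++-assoc; map-++; map-applyUpTo; length-applyUpTo)
open import Data.List.Relation.Unary.All as All using (All; []; _∷_)
import Data.List.Relation.Unary.All.Properties as All
open import Data.List.Relation.Unary.Any using (here; there)
open import Data.List.Relation.Unary.First using (FirstView; first)
import Data.List.Relation.Unary.First as First
open import Data.List.Relation.Unary.First.Properties using (toView)
open import Data.List.Relation.Unary.Unique.Propositional using (Unique; []; _∷_)
import Data.List.Relation.Unary.Unique.Propositional.Properties as Unique
open import Data.List.Membership.Propositional using (_∈_; _∉_)
open import Data.List.Membership.Propositional.Properties using (∈-++⁺ʳ; ∈-++⁻; ∈-∃++)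
open import Data.Product using (∃-syntax; _×_; _,_; proj₁; proj₂)
open import Data.Sum using (inj₁; inj₂; swap)
open import Data.Unit using (⊤; tt)
open import Data.Empty using (⊥-elim)
open import Function using (_∘_)
open import Function.Definitions using (Injective)
open import Relation.Nullary.Decidable using (toSum)
open import Relation.Binary.PropositionalEquality using (_≡_; _≢_; refl; sym; trans; cong; subst; module ≡-Reasoning)

module _ {A : Set} where

  pairs-++-∷ : ∀ (xs : List A) y ys → pairs (xs ++ y ∷ ys) ≡ pairs (xs ++ y ∷ []) ++ pairs (y ∷ ys)
  pairs-++-∷ []           y ys = refl
  pairs-++-∷ (x ∷ [])     y ys = refl
  pairs-++-∷ (x ∷ x′ ∷ xs) y ys = cong ((x , x′) ∷_) (pairs-++-∷ (x′ ∷ xs) y ys)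

  module _ {P : A × A → Set} where

    All-pairs-++-∷⁻ : ∀ xs y ys → All P (pairs (xs ++ y ∷ ys)) →
                      All P (pairs (xs ++ y ∷ [])) × All P (pairs (y ∷ ys))
    All-pairs-++-∷⁻ xs y ys p = All.++⁻ (pairs (xs ++ y ∷ [])) (subst (All P) (pairs-++-∷ xs y ys) p)

    All-pairs-++-∷⁺ : ∀ xs y ys → All P (pairs (xs ++ y ∷ [])) → All P (pairs (y ∷ ys)) →
                      All P (pairs (xs ++ y ∷ ys))
    All-pairs-++-∷⁺ xs y ys p q = subst (All P) (sym (pairs-++-∷ xs y ys)) (All.++⁺ p q)

    All-pairs-++⁻ʳ : ∀ xs ys → All P (pairs (xs ++ ys)) → All P (pairs ys)
    All-pairs-++⁻ʳ []           ys       p       = p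
    All-pairs-++⁻ʳ (x ∷ [])     []       p       = []
    All-pairs-++⁻ʳ (x ∷ [])     (y ∷ ys) (_ ∷ p) = p
    All-pairs-++⁻ʳ (x ∷ x′ ∷ xs) ys      (_ ∷ p) = All-pairs-++⁻ʳ (x′ ∷ xs) ys p

  lastOf : A → List A → A
  lastOf x []       = x
  lastOf x (y ∷ xs) = lastOf y xs

  lastOf-++-∷ : ∀ {x : A} xs {y} ys → lastOf x (xs ++ y ∷ ys) ≡ lastOf y ys
  lastOf-++-∷ []       ys = refl
  lastOf-++-∷ (x ∷ xs) ys = lastOf-++-∷ xs ys

  lastOf-split : ∀ {x : A} {xs z zs} ys → x ∷ xs ≡ ys ++ z ∷ zs → lastOf x xs ≡ lastOf z zs
  lastOf-split []       refl = refl
  lastOf-split (y ∷ ys) refl = lastOf-++-∷ ys _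

  lastPair∈pairs : ∀ (x : A) xs y → (lastOf x xs , y) ∈ pairs (x ∷ xs ++ y ∷ [])
  lastPair∈pairs x []       y = here refl
  lastPair∈pairs x (x′ ∷ xs) y = there (lastPair∈pairs x′ xs y)

  Unique-++⁻ˡ : ∀ (xs : List A) {ys} → Unique (xs ++ ys) → Unique xs
  Unique-++⁻ˡ []       _        = []
  Unique-++⁻ˡ (x ∷ xs) (x∉ ∷ u) = All.++⁻ˡ xs x∉ ∷ Unique-++⁻ˡ xs u

  Unique-++⁻ʳ : ∀ (xs : List A) {ys} → Unique (xs ++ ys) → Unique ys
  Unique-++⁻ʳ []       u       = u
  Unique-++⁻ʳ (x ∷ xs) (_ ∷ u) = Unique-++⁻ʳ xs u

  Unique-++⇒disjoint : ∀ (xs : List A) {ys v} → Unique (xs ++ ys) → v ∈ xs → v ∉ ys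
  Unique-++⇒disjoint (x ∷ xs) (x∉ ∷ _) (here refl) v∈ys = All.lookup (All.++⁻ʳ xs x∉) v∈ys refl
  Unique-++⇒disjoint (x ∷ xs) (_ ∷ u)  (there v∈xs) v∈ys = Unique-++⇒disjoint xs u v∈xs v∈ys

  Unique-++-∷⁻ : ∀ (xs : List A) {y ys} → Unique (xs ++ y ∷ ys) → Unique (xs ++ ys)
  Unique-++-∷⁻ []       (_ ∷ u)  = u
  Unique-++-∷⁻ (x ∷ xs) (x∉ ∷ u) with All.++⁻ xs x∉
  ... | x∉xs , (_ ∷ x∉ys) = All.++⁺ x∉xs x∉ys ∷ Unique-++-∷⁻ xs u

  length-++-∷-∷ : ∀ (xs : List A) y z {w} ys → length (xs ++ y ∷ z ∷ ys) ≡ suc (length (xs ++ w ∷ ys))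
  length-++-∷-∷ []       y z ys = refl
  length-++-∷-∷ (x ∷ xs) y z ys = cong suc (length-++-∷-∷ xs y z ys)

module Paths (Δ : HColoredDigraph) {k : ℕ} (part : Fin (hV Δ) → Fin k) where

  V : Set
  V = Fin (dV Δ)

  classOf : V → V → Fin k
  classOf x y = part (c Δ x y)

  InClass : Fin k → V → List V → V → Set
  InClass j x ms y = ContainedIn Δ part j (seq Δ x ms y)

  HPath : V → List V → V → Set
  HPath x ms y = IsHPath Δ (seq Δ x ms y)

  IsPath : List V → Set
  IsPath vs = IsWalk Δ vs × Unique vs

  HPath⇒IsPath : ∀ {x ms y} → HPath x ms y → IsPath (seq Δ x ms y)
  HPath⇒IsPath ((walk , _) , unique) = walk , unique

  arcClass : ∀ {j vs x y} → ContainedIn Δ part j vs → (x , y) ∈ pairs vs → classOf x y ≡ j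
  arcClass inClass = All.lookup inClass

  InClass-unique : ∀ {i j} x ms y → InClass i x ms y → InClass j x ms y → i ≡ j
  InClass-unique x []      y (p ∷ _) (q ∷ _) = trans (sym p) q
  InClass-unique x (_ ∷ _) y (p ∷ _) (q ∷ _) = trans (sym p) q

  seq-++ : ∀ x ms y ms′ z → seq Δ x (ms ++ y ∷ ms′) z ≡ (x ∷ ms) ++ y ∷ ms′ ++ z ∷ []
  seq-++ x ms y ms′ z = cong (x ∷_) (++-assoc ms (y ∷ ms′) (z ∷ []))

  seq-split : ∀ {x ms z zs} ys y → x ∷ ms ≡ ys ++ z ∷ zs → seq Δ x ms y ≡ ys ++ seq Δ z zs y
  seq-split ys y eq = trans (cong (_++ y ∷ []) eq) (++-assoc ys _ (y ∷ []))

  module _ {P : V × V → Set} where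

    All-pairs-seq-++⁻ : ∀ x ms y ms′ z → All P (pairs (seq Δ x (ms ++ y ∷ ms′) z)) →
                        All P (pairs (seq Δ x ms y)) × All P (pairs (seq Δ y ms′ z))
    All-pairs-seq-++⁻ x ms y ms′ z p =
      All-pairs-++-∷⁻ (x ∷ ms) y _ (subst (All P ∘ pairs) (seq-++ x ms y ms′ z) p)

    All-pairs-seq-++⁺ : ∀ x ms y ms′ z → All P (pairs (seq Δ x ms y)) → All P (pairs (seq Δ y ms′ z)) →
                        All P (pairs (seq Δ x (ms ++ y ∷ ms′) z))
    All-pairs-seq-++⁺ x ms y ms′ z p q =
      subst (All P ∘ pairs) (sym (seq-++ x ms y ms′ z)) (All-pairs-++-∷⁺ (x ∷ ms) y _ p q)

  IsPath-++ : ∀ {x ms y ms′ z} → IsPath (seq Δ x ms y) → IsPath (seq Δ y ms′ z) →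
              All (_∉ seq Δ x ms y) (ms′ ++ z ∷ []) → IsPath (seq Δ x (ms ++ y ∷ ms′) z)
  IsPath-++ {x} {ms} {y} {ms′} {z} (walk , unique) (walk′ , _ ∷ unique′) avoid =
    All-pairs-seq-++⁺ x ms y ms′ z walk walk′ ,
    subst Unique (sym eq) (Unique.++⁺ unique unique′ λ (v∈ , v∈′) → All.lookup avoid v∈′ v∈)
    where
    eq : seq Δ x (ms ++ y ∷ ms′) z ≡ seq Δ x ms y ++ ms′ ++ z ∷ []
    eq = trans (seq-++ x ms y ms′ z) (sym (++-assoc (x ∷ ms) (y ∷ []) _))

  IsPath-suffix : ∀ {x ms z zs} ys y → x ∷ ms ≡ ys ++ z ∷ zs → IsPath (seq Δ x ms y) → IsPath (seq Δ z zs y)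
  IsPath-suffix ys y eq (walk , unique) =
    All-pairs-++⁻ʳ ys _ (subst (IsWalk Δ) (seq-split ys y eq) walk) ,
    Unique-++⁻ʳ ys (subst Unique (seq-split ys y eq) unique)

  closedWalk-isCycle : ∀ {z zs y t} → IsPath (seq Δ z zs y) → IsWalk Δ (seq Δ y t z) → Unique t →
                       All (_∉ seq Δ z zs y) t → IsWalk Δ (seq Δ z (zs ++ y ∷ t) z) × Unique (z ∷ zs ++ y ∷ t)
  closedWalk-isCycle {z} {zs} {y} {t} (walk , unique) walk′ uniqueT avoid =
    All-pairs-seq-++⁺ z zs y t z walk walk′ ,
    subst Unique (cong (z ∷_) (++-assoc zs (y ∷ []) t))
      (Unique.++⁺ unique uniqueT λ (v∈ , v∈t) → All.lookup avoid v∈t v∈)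

  Seg : Set
  Seg = List V × V

  Chain : (V → List V → V → Set) → V → List Seg → Set
  Chain P a []              = ⊤
  Chain P a ((ms , y) ∷ ss) = P a ms y × Chain P y ss

  end : V → List Seg → V
  end a []              = a
  end a ((ms , y) ∷ ss) = end y ss

  ends : List Seg → List V
  ends = map proj₂

  Unique-ends-merge : ∀ pre {s₁ ms₂ ms y} post → Unique (ends (pre ++ s₁ ∷ (ms₂ , y) ∷ post)) →
                      Unique (ends (pre ++ (ms , y) ∷ post))
  Unique-ends-merge pre post unique =
    subst Unique (sym (map-++ proj₂ pre _)) (Unique-++-∷⁻ (ends pre) (subst Unique (map-++ proj₂ pre _) unique))

  end-++ : ∀ a (xs ys : List Seg) → end a (xs ++ ys) ≡ end (end a xs) ys
  end-++ a []              ys = refl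
  end-++ a ((ms , y) ∷ xs) ys = end-++ y xs ys

  end∈ends : ∀ a s ss → end a (s ∷ ss) ∈ ends (s ∷ ss)
  end∈ends a (ms , y) []       = here refl
  end∈ends a (ms , y) (s ∷ ss) = there (end∈ends y s ss)

  module _ {P : V → List V → V → Set} where

    Chain-++⁻ : ∀ a xs ys → Chain P a (xs ++ ys) → Chain P a xs × Chain P (end a xs) ys
    Chain-++⁻ a []              ys ch        = tt , ch
    Chain-++⁻ a ((ms , y) ∷ xs) ys (p , ch) with Chain-++⁻ y xs ys ch
    ... | chx , chy = (p , chx) , chy

    Chain-++⁺ : ∀ a xs ys → Chain P a xs → Chain P (end a xs) ys → Chain P a (xs ++ ys)
    Chain-++⁺ a []              ys _         chy = chy
    Chain-++⁺ a ((ms , y) ∷ xs) ys (p , chx) chy = p , Chain-++⁺ y xs ys chx chy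

    Chain-applyUpTo⁺ : ∀ (w : ℕ → V) t n → (∀ {r} → r < n → P (w r) (t r) (w (suc r))) →
                       Chain P (w 0) (applyUpTo (λ r → t r , w (suc r)) n)
    Chain-applyUpTo⁺ w t zero    p = tt
    Chain-applyUpTo⁺ w t (suc n) p = p z<s , Chain-applyUpTo⁺ (w ∘ suc) (t ∘ suc) n (λ r<n → p (s<s r<n))

    Chain-applyUpTo⁻ : ∀ (w : ℕ → V) t n → Chain P (w 0) (applyUpTo (λ r → t r , w (suc r)) n) →
                       ∀ {r} → r < n → P (w r) (t r) (w (suc r))
    Chain-applyUpTo⁻ w t (suc n) (p , _)  {zero}  _         = p
    Chain-applyUpTo⁻ w t (suc n) (_ , ch) {suc r} (s<s r<n) = Chain-applyUpTo⁻ (w ∘ suc) (t ∘ suc) n ch r<n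

  end-applyUpTo : ∀ (w : ℕ → V) t n → end (w 0) (applyUpTo (λ r → t r , w (suc r)) n) ≡ w n
  end-applyUpTo w t zero    = refl
  end-applyUpTo w t (suc n) = end-applyUpTo (w ∘ suc) (t ∘ suc) n

module ClosedChains (Δ : HColoredDigraph) {k : ℕ} (part : Fin (hV Δ) → Fin k)
  (transitive : ∀ j → TransitiveByHPaths Δ part j)
  (cyclesInClass : ∀ v w ws → IsCycle Δ v w ws → ∃[ i ] ContainedIn Δ part i (v ∷ w ∷ ws ++ v ∷ []))
  (hWalksInClass : ∀ x ms y → IsHWalk Δ (seq Δ x ms y) → ∃[ j ] ContainedIn Δ part j (seq Δ x ms y)) where

  open Paths Δ part
  open import Data.List.Membership.DecPropositional {A = V} _≟_ using (_∈?_)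

  cycleClass : ∀ z zs y t → IsWalk Δ (seq Δ z (zs ++ y ∷ t) z) × Unique (z ∷ zs ++ y ∷ t) →
               ∃[ i ] InClass i z (zs ++ y ∷ t) z
  cycleClass z []       y t = cyclesInClass z y t
  cycleClass z (w ∷ zs) y t = cyclesInClass z w (zs ++ y ∷ t)

  junctionCycle : ∀ {a ms y z t₁ t₂} ys zs → a ∷ ms ≡ ys ++ z ∷ zs →
                  IsPath (seq Δ a ms y) → IsPath (y ∷ t₁ ++ z ∷ t₂) → All (_∉ seq Δ a ms y) t₁ →
                  IsWalk Δ (seq Δ z (zs ++ y ∷ t₁) z) × Unique (z ∷ zs ++ y ∷ t₁)
  junctionCycle {y = y} {z} {t₁} {t₂} ys zs split P (walkQ , _ ∷ uniqueQ) avoid =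
    closedWalk-isCycle (IsPath-suffix ys y split P) (proj₁ (All-pairs-++-∷⁻ (y ∷ t₁) z t₂ walkQ))
      (Unique-++⁻ˡ t₁ uniqueQ)
      (All.map (λ v∉ v∈ → v∉ (subst (_ ∈_) (sym (seq-split ys y split)) (∈-++⁺ʳ ys v∈))) avoid)

  junctionClass : ∀ {a ms y j z t₁ t₂} ys zs → a ∷ ms ≡ ys ++ z ∷ zs →
                  IsPath (seq Δ a ms y) → IsPath (y ∷ t₁ ++ z ∷ t₂) → All (_∉ seq Δ a ms y) t₁ →
                  ContainedIn Δ part j (y ∷ t₁ ++ z ∷ t₂) → classOf (lastOf a ms) y ≡ j
  junctionClass {a} {ms} {y} {j} {z} {t₁} {t₂} ys zs split P Q avoid inQ
    with cycleClass z zs y t₁ (junctionCycle ys zs split P Q avoid)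
  ... | i , inCycle with All-pairs-seq-++⁻ z zs y t₁ z inCycle
  ... | inSuffix , inPrefix = begin
      classOf (lastOf a ms) y ≡⟨ cong (λ v → classOf v y) (lastOf-split ys split) ⟩
      classOf (lastOf z zs) y ≡⟨ arcClass inSuffix (lastPair∈pairs z zs y) ⟩
      i                       ≡⟨ InClass-unique y t₁ z inPrefix inQ-prefix ⟩
      j                       ∎
    where
    open ≡-Reasoning
    inQ-prefix : InClass j y t₁ z
    inQ-prefix = proj₁ (All-pairs-++-∷⁻ (y ∷ t₁) z t₂ inQ)

  closingArc-sameClass : ∀ {a ms y j} t → IsPath (seq Δ a ms y) → IsPath (y ∷ t) →
                         FirstView (_∉ seq Δ a ms y) (_∈ seq Δ a ms y) t →
                         ContainedIn Δ part j (y ∷ t) → classOf (lastOf a ms) y ≡ j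
  closingArc-sameClass {a} {ms} _ P Q@(_ , y∉ ∷ _) (First._++_∷_ {t₁} avoid z∈P t₂) inQ
    with ∈-++⁻ (a ∷ ms) z∈P
  ... | inj₂ (here refl) = ⊥-elim (All.lookup y∉ (∈-++⁺ʳ t₁ (here refl)) refl)
  ... | inj₁ z∈ with ∈-∃++ z∈
  ...   | ys , zs , split = junctionClass ys zs split P Q avoid inQ

  data Junction (b : V) : List Seg → Set where
    junction : ∀ pre ms₁ y₁ ms₂ y₂ post j → InClass j (end b pre) ms₁ y₁ → InClass j y₁ ms₂ y₂ →
               Junction b (pre ++ (ms₁ , y₁) ∷ (ms₂ , y₂) ∷ post)

  Junction-∷ : ∀ {b y segs} ms → Junction y segs → Junction b ((ms , y) ∷ segs)
  Junction-∷ ms (junction pre ms₁ y₁ ms₂ y₂ post j in₁ in₂) =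
    junction ((ms , _) ∷ pre) ms₁ y₁ ms₂ y₂ post j in₁ in₂

  -- seq a ms y is the concatenation of the paths scanned so far; it stays a path, and its last arc
  -- lies in the class j₁ of the last scanned path.
  extendJunction : ∀ {a b ms₁ y j₁} ms rest → InClass j₁ b ms₁ y → IsPath (seq Δ a ms y) →
                   classOf (lastOf a ms) y ≡ j₁ → Chain HPath y rest → end y rest ≡ a →
                   Junction b ((ms₁ , y) ∷ rest)
  extendJunction ms [] _ (_ , a∉ ∷ _) _ _ refl = ⊥-elim (All.lookup a∉ (∈-++⁺ʳ ms (here refl)) refl)
  extendJunction {a} {y = y} ms ((ms₂ , y₂) ∷ rest) in₁ P last (hp₂ , ch) closed
    with hWalksInClass y ms₂ y₂ (proj₁ hp₂)
       | first (λ v → swap (toSum (v ∈? seq Δ a ms y))) (ms₂ ++ y₂ ∷ [])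
  ... | j₂ , in₂ | inj₁ meets =
    junction [] _ y ms₂ y₂ rest _ in₁
      (subst (λ j → InClass j y ms₂ y₂)
        (trans (sym (closingArc-sameClass _ P (HPath⇒IsPath hp₂) (toView meets) in₂)) last) in₂)
  ... | j₂ , in₂ | inj₂ avoids =
    Junction-∷ _ (extendJunction (ms ++ y ∷ ms₂) rest in₂ (IsPath-++ P (HPath⇒IsPath hp₂) avoids)
      (trans (cong (λ v → classOf v y₂) (lastOf-++-∷ ms ms₂)) (arcClass in₂ (lastPair∈pairs y ms₂ y₂)))
      ch closed)

  findJunction : ∀ {a} ms y rest → Chain HPath a ((ms , y) ∷ rest) → end y rest ≡ a →
                 Junction a ((ms , y) ∷ rest)
  findJunction {a} ms y rest (hp , ch) closed with hWalksInClass a ms y (proj₁ hp)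
  ... | j , inj = extendJunction ms rest inj (HPath⇒IsPath hp) (arcClass inj (lastPair∈pairs a ms y)) ch closed

  Monochromatic : V → List Seg → Set
  Monochromatic a segs = ∃[ j ] Chain (InClass j) a segs

  ClosedChainsMonochromatic : ℕ → Set
  ClosedChainsMonochromatic n = ∀ a segs → length segs ≤ n → Chain HPath a segs → Unique (ends segs) →
                                end a segs ≡ a → Monochromatic a segs

  mergeJunction : ∀ {n a} pre ms₁ y₁ ms₂ y₂ post {j} →
                  length (pre ++ (ms₁ , y₁) ∷ (ms₂ , y₂) ∷ post) ≤ suc n →
                  Chain HPath a (pre ++ (ms₁ , y₁) ∷ (ms₂ , y₂) ∷ post) →
                  Unique (ends (pre ++ (ms₁ , y₁) ∷ (ms₂ , y₂) ∷ post)) →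
                  end y₂ post ≡ a → end a pre ≢ y₂ →
                  InClass j (end a pre) ms₁ y₁ → InClass j y₁ ms₂ y₂ → ClosedChainsMonochromatic n →
                  Monochromatic a (pre ++ (ms₁ , y₁) ∷ (ms₂ , y₂) ∷ post)
  mergeJunction {n} {a} pre ms₁ y₁ ms₂ y₂ post {j} len ch unique closed b≢y₂ in₁ in₂ ih =
    let chPre , hp₁ , hp₂ , chPost = Chain-++⁻ a pre _ ch
        ms₃ , hp₃ , in₃ = transitive j (end a pre) y₁ y₂ ms₁ ms₂ b≢y₂ (hp₁ , in₁) (hp₂ , in₂)
        j′ , ch′ = ih a (pre ++ (ms₃ , y₂) ∷ post)
                     (s≤s⁻¹ (subst (_≤ suc n) (length-++-∷-∷ pre _ _ post) len))
                     (Chain-++⁺ a pre _ chPre (hp₃ , chPost)) (Unique-ends-merge pre post unique)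
                     (trans (end-++ a pre _) closed)
        chPre′ , in₃′ , chPost′ = Chain-++⁻ a pre _ ch′
        in₁′ , in₂′ = subst (λ i → InClass i (end a pre) ms₁ y₁ × InClass i y₁ ms₂ y₂)
                        (InClass-unique _ ms₃ y₂ in₃ in₃′) (in₁ , in₂)
    in j′ , Chain-++⁺ a pre _ chPre′ (in₁′ , in₂′ , chPost′)

  -- Merging needs the two paths at the junction to have distinct outer ends, which the distinct
  -- endpoints guarantee unless they are the whole chain.
  Junction-monochromatic : ∀ {n a segs} → length segs ≤ suc n → Chain HPath a segs → Unique (ends segs) →
                           end a segs ≡ a → Junction a segs → ClosedChainsMonochromatic n → Monochromatic a segs
  Junction-monochromatic _ _ _ _ (junction [] _ _ _ _ [] j in₁ in₂) _ = j , in₁ , in₂ , tt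
  Junction-monochromatic len ch unique@(_ ∷ y₂∉ ∷ _) closed
                         (junction [] ms₁ y₁ ms₂ y₂ (s ∷ post) j in₁ in₂) ih =
    mergeJunction [] ms₁ y₁ ms₂ y₂ (s ∷ post) len ch unique closed
      (λ a≡y₂ → All.lookup y₂∉ (subst (_∈ ends (s ∷ post)) (trans closed a≡y₂) (end∈ends y₂ s post))
                  refl)
      in₁ in₂ ih
  Junction-monochromatic {a = a} len ch unique closed (junction (p ∷ pre) ms₁ y₁ ms₂ y₂ post j in₁ in₂) ih =
    mergeJunction (p ∷ pre) ms₁ y₁ ms₂ y₂ post len ch unique (trans (sym (end-++ a (p ∷ pre) _)) closed)
      (λ b≡y₂ → Unique-++⇒disjoint (ends (p ∷ pre)) (subst Unique (map-++ proj₂ (p ∷ pre) _) unique)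
                  (end∈ends a p pre) (there (here b≡y₂)))
      in₁ in₂ ih

  -- j₀ only serves as the class of the empty chain.
  closedChain-monochromatic : Fin k → ∀ n → ClosedChainsMonochromatic n
  closedChain-monochromatic j₀ n       a []                _   _  _      _      = j₀ , tt
  closedChain-monochromatic j₀ zero    a (_ ∷ _)           ()  _  _      _
  closedChain-monochromatic j₀ (suc n) a ((ms , y) ∷ rest) len ch unique closed =
    Junction-monochromatic len ch unique closed (findJunction ms y rest ch closed) (closedChain-monochromatic j₀ n)

  cyclicSequence-monochromatic : Fin k → ∀ (w : ℕ → V) t n →
                                 (∀ {r} → r < n → HPath (w r) (t r) (w (suc r))) →
                                 (∀ {i j} → i < j → j < n → w (suc i) ≢ w (suc j)) → w n ≡ w 0 →
                                 ∃[ j ] (∀ {r} → r < n → InClass j (w r) (t r) (w (suc r)))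
  cyclicSequence-monochromatic j₀ w t n hp distinct closed =
    let j , ch = closedChain-monochromatic j₀ n (w 0) (applyUpTo (λ r → t r , w (suc r)) n)
                   (≤-reflexive (length-applyUpTo _ n)) (Chain-applyUpTo⁺ w t n hp)
                   (subst Unique (sym (map-applyUpTo _ proj₂ n)) (Unique.applyUpTo⁺₁ (w ∘ suc) n distinct))
                   (trans (end-applyUpTo w t n) closed)
    in j , Chain-applyUpTo⁻ w t n ch

module _ {m : ℕ} where

  iterNextMod : ℕ → Fin (suc (suc m))
  iterNextMod zero    = zero
  iterNextMod (suc r) = nextMod (iterNextMod r)

  toℕ-nextMod : ∀ i → toℕ (nextMod i) ≡ suc (toℕ i) % suc (suc m)
  toℕ-nextMod i = toℕ-fromℕ< _

  toℕ-iterNextMod : ∀ {r} → r < suc (suc m) → toℕ (iterNextMod r) ≡ r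
  toℕ-iterNextMod {zero}  _   = refl
  toℕ-iterNextMod {suc r} r<N = begin
    toℕ (nextMod (iterNextMod r))
      ≡⟨ toℕ-nextMod (iterNextMod r) ⟩
    suc (toℕ (iterNextMod r)) % suc (suc m)
      ≡⟨ cong (λ x → suc x % suc (suc m)) (toℕ-iterNextMod (≤-trans (n≤1+n _) r<N)) ⟩
    suc r % suc (suc m)
      ≡⟨ m<n⇒m%n≡m r<N ⟩
    suc r ∎
    where open ≡-Reasoning

  iterNextMod-toℕ : ∀ i → iterNextMod (toℕ i) ≡ i
  iterNextMod-toℕ i = toℕ-injective (toℕ-iterNextMod (toℕ<n i))

  iterNextMod-period : iterNextMod (suc (suc m)) ≡ zero
  iterNextMod-period = toℕ-injective (begin
    toℕ (nextMod (iterNextMod (suc m)))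
      ≡⟨ toℕ-nextMod (iterNextMod (suc m)) ⟩
    suc (toℕ (iterNextMod (suc m))) % suc (suc m)
      ≡⟨ cong (λ x → suc x % suc (suc m)) (toℕ-iterNextMod ≤-refl) ⟩
    suc (suc m) % suc (suc m)
      ≡⟨ n%n≡0 (suc (suc m)) ⟩
    0 ∎)
    where open ≡-Reasoning

  iterNextMod-distinct : ∀ {i j} → i < j → j < suc (suc m) → iterNextMod (suc i) ≢ iterNextMod (suc j)
  iterNextMod-distinct {i} {j} i<j j<N eq with m≤n⇒m<n∨m≡n j<N
  ... | inj₁ 1+j<N = <-irrefl (suc-injective (trans (sym (toℕ-iterNextMod (<-trans (s<s i<j) 1+j<N)))
                                               (trans (cong toℕ eq) (toℕ-iterNextMod 1+j<N)))) i<j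
  ... | inj₂ 1+j≡N = 1+n≢0 (trans (sym (toℕ-iterNextMod (≤-trans (s≤s i<j) j<N)))
                                  (cong toℕ (trans eq (trans (cong iterNextMod 1+j≡N) iterNextMod-period))))

mainTheorem4 : (Δ : HColoredDigraph) → Loopless Δ → NoIsolated Δ →
    (k : ℕ) → 2 ≤ k → (part : Fin (hV Δ) → Fin k) →
    (∀ j → ArcClassNonempty Δ part j) →
    (∀ j → TransitiveByHPaths Δ part j) →
    (∀ v w ws → IsCycle Δ v w ws → ∃[ i ] ContainedIn Δ part i (v ∷ w ∷ ws ++ v ∷ [])) →
    (∀ x ms y → IsHWalk Δ (seq Δ x ms y) → ∃[ j ] ContainedIn Δ part j (seq Δ x ms y)) →
    (m : ℕ) → (u : Fin (suc (suc m)) → Fin (dV Δ)) → Injective _≡_ _≡_ u →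
    (T : Fin (suc (suc m)) → List (Fin (dV Δ))) →
    (∀ i → IsHPath Δ (seq Δ (u i) (T i) (u (nextMod i)))) →
    ∃[ j ] (∀ i → ContainedIn Δ part j (seq Δ (u i) (T i) (u (nextMod i))))
mainTheorem4 Δ _ _ _ (s≤s (s≤s _)) part _ transitive cyclesInClass hWalksInClass m u u-injective T hp =
  let j , inClass = cyclicSequence-monochromatic zero (u ∘ iterNextMod) (T ∘ iterNextMod) (suc (suc m))
                      (λ {r} _ → hp (iterNextMod r))
                      (λ i<j j<N → iterNextMod-distinct i<j j<N ∘ u-injective)
                      (cong u iterNextMod-period)
  in j , λ i → subst (λ i → ContainedIn Δ part j (seq Δ (u i) (T i) (u (nextMod i))))
                     (iterNextMod-toℕ i) (inClass (toℕ<n i))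
  where open ClosedChains Δ part transitive cyclesInClass hWalksInClass
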